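{- Let $M$ be a positive integer and let $\mathcal{G}_M^0$ be the collection of isomorphism classes of nonempty finite graphs of maximal degree at most $M$. The restriction of the law map $\Psi$ to the set of graphs in $\mathcal{G}_M^0$ whose connected components are pairwise nonisomorphic is injective: if $G,H$ are two such graphs with $\Psi(G)=\Psi(H)$, then $G\cong H$.
   Context: All graphs are simple. A rooted graph $(G,o)$ has $o\in V(G)$; isomorphisms of rooted graphs map root to root; $[G,o]$ is the isomorphism class. $\widehat{\mathcal{G}}_M$ is the set of isomorphism classes of connected rooted graphs of maximal degree at most $M$. For a graph $G$ and vertex $x$, $G_x$ is the connected component containing $x$. For $G\in\mathcal{G}_M^0$, the law $\Psi(G)$ is the probability measure on $\widehat{\mathcal{G}}_M$ given by $\Psi(G)(\{[G_o,o]\})=|\mathrm{Aut}(G)o|/|V(G)|$ for $o\in V(G)$ and $0$ elsewhere, where $\mathrm{Aut}(G)o$ is the orbit of $o$ under the automorphism group of $G$. -}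

module Defs where

open import Data.Nat using (ℕ; zero; suc; _+_; _*_; _≤_; _<_)
open import Data.Fin using (Fin; zero; suc)
open import Data.Bool using (Bool; true; false; if_then_else_)
open import Data.List using (List; length)
open import Data.List.Relation.Unary.Unique.Propositional using (Unique)
open import Data.List.Membership.Propositional using (_∈_)
open import Data.Product using (Σ; _×_; _,_)
open import Data.Sum using (_⊎_)
open import Relation.Nullary using (¬_)
open import Relation.Binary.PropositionalEquality using (_≡_)

record Graph : Set where
  field
    n      : ℕ
    adj    : Fin n → Fin n → Bool
    sym    : ∀ x y → adj x y ≡ adj y x
    irrefl : ∀ x → adj x x ≡ false
open Graph public

countTrue : ∀ {k} → (Fin k → Bool) → ℕ
countTrue {zero}  p = 0
countTrue {suc k} p = (if p zero then 1 else 0) + countTrue (λ i → p (suc i))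

degree : (G : Graph) → Fin (n G) → ℕ
degree G x = countTrue (adj G x)

MaxDegAtMost : ℕ → Graph → Set
MaxDegAtMost M G = ∀ x → degree G x ≤ M

data Reach (G : Graph) (x : Fin (n G)) : Fin (n G) → Set where
  here : Reach G x x
  step : ∀ {y z} → Reach G x y → adj G y z ≡ true → Reach G x z

Connected : Graph → Set
Connected G = ∀ x y → Reach G x y

record Iso (G H : Graph) : Set where
  field
    to      : Fin (n G) → Fin (n H)
    from    : Fin (n H) → Fin (n G)
    from-to : ∀ v → from (to v) ≡ v
    to-from : ∀ w → to (from w) ≡ w
    adj-pres : ∀ v w → adj H (to v) (to w) ≡ adj G v w
open Iso public

-- Isomorphism between the components G_x and H_y (as unrooted graphs):
-- a bijection between the vertex sets of the components preserving adjacency.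
record CompIso (G : Graph) (x : Fin (n G)) (H : Graph) (y : Fin (n H)) : Set where
  field
    cto      : Fin (n G) → Fin (n H)
    cfrom    : Fin (n H) → Fin (n G)
    cto-reach   : ∀ v → Reach G x v → Reach H y (cto v)
    cfrom-reach : ∀ w → Reach H y w → Reach G x (cfrom w)
    cfrom-to : ∀ v → Reach G x v → cfrom (cto v) ≡ v
    cto-from : ∀ w → Reach H y w → cto (cfrom w) ≡ w
    cadj-pres : ∀ v w → Reach G x v → Reach G x w →
                adj H (cto v) (cto w) ≡ adj G v w
open CompIso public

RootedIso : (G : Graph) → Fin (n G) → (H : Graph) → Fin (n H) → Set
RootedIso G x H y = Σ (CompIso G x H y) λ φ → cto φ x ≡ y

-- Connected components of G are pairwise nonisomorphic:
-- if G_x ≅ G_y then G_x and G_y are the same component.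
DistinctComponents : Graph → Set
DistinctComponents G = ∀ x y → CompIso G x G y → Reach G x y

InOrbit : (G : Graph) → Fin (n G) → Fin (n G) → Set
InOrbit G o v = Σ (Iso G G) λ σ → to σ o ≡ v

IsCard : ∀ {k} → (Fin k → Set) → ℕ → Set
IsCard {k} P c = Σ (List (Fin k)) λ xs →
  Unique xs × length xs ≡ c × (∀ v → (P v → v ∈ xs) × (v ∈ xs → P v))

-- Ψ(G)({[C,r]}) = m / |V(G)|  (numerator m):
-- m = |Aut(G)o| if some o has [G_o,o] = [C,r], and m = 0 otherwise.
PsiNum : (G : Graph) (C : Graph) → Fin (n C) → ℕ → Set
PsiNum G C r m =
  (Σ (Fin (n G)) λ o → RootedIso G o C r × IsCard (InOrbit G o) m)
  ⊎ ((¬ Σ (Fin (n G)) λ o → RootedIso G o C r) × m ≡ 0)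

-- Ψ(G) = Ψ(H) as measures on the rooted connected graphs of max degree ≤ M
-- (both are finitely supported on finite classes, so it suffices to compare
-- point masses at finite connected rooted graphs; equality of rationals
-- m₁ / |V(G)| = m₂ / |V(H)| is written by cross-multiplication).
LawEq : ℕ → Graph → Graph → Set
LawEq M G H = ∀ (C : Graph) (r : Fin (n C)) → Connected C → MaxDegAtMost M C →
  ∀ m₁ m₂ → PsiNum G C r m₁ → PsiNum H C r m₂ → m₁ * n H ≡ m₂ * n G

module Submission where

-- Fix a vertex o of G with component C. Because the components of G are pairwise non-isomorphic,
-- every isomorphism G_o ≅ G_v extends by the identity to an automorphism, so the orbit of o is the
-- set of v with (G_v, v) ≅ (C, o), and it is nonempty. Equality of the laws at [C, o] therefore
-- forces a vertex o′ of H with (H_o′, o′) ≅ (C, o); the same description of orbits in H shows that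
-- the orbits of o and o′ have the same size m, and m·|H| = m·|G| gives |G| = |H|. Gluing the
-- isomorphisms G_v ≅ H_o′ over one representative v per component yields a map G → H that respects
-- adjacency; it is injective because two components of G sent into the same component of H would be
-- isomorphic, hence bijective as |G| = |H|. Deciding reachability, orbit membership and the
-- existence of o′ is classical, so the argument runs in the double-negation monad; this is harmless
-- because isomorphism of finite graphs is decidable.

open import Defs hiding (sym)
open import Data.Bool using (Bool; true; false)
import Data.Bool.Properties as Bool
open import Data.Empty using (⊥-elim)
open import Data.Fin using (Fin; zero; suc; fromℕ<; punchOut)
open import Data.Fin.Properties using (any?; all?; injective⇒≤; punchOut-injective; sequence)
  renaming (_≟_ to _≟ᶠ_)
open import Data.List using (List; []; _∷_; length; map; lookup; filter; find; tabulate; allFin)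
open import Data.List.Membership.Propositional using (_∈_)
open import Data.List.Membership.Propositional.Properties using (∈-map⁺; ∈-map⁻; ∈-lookup; ∈-allFin; ∈-filter⁺; ∈-filter⁻)
open import Data.List.Properties using (length-map; map-∘; map-id-local; tabulate-lookup)
open import Data.List.Relation.Binary.Sublist.Propositional.Properties using (filter-⊆; length-mono-≤)
  renaming (filter⁺ to filter⁺-⊆)
open import Data.List.Relation.Unary.All as All using (All)
open import Data.List.Relation.Unary.Any as Any using (Any; here; there)
open import Data.List.Relation.Unary.Any.Properties using (lookup-index)
open import Data.List.Relation.Unary.AllPairs using (_∷_)
open import Data.List.Relation.Unary.Unique.Propositional using (Unique)
open import Data.List.Relation.Unary.Unique.Propositional.Properties using (map⁻; allFin⁺)
  renaming (filter⁺ to filter⁺-Unique)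
open import Data.Maybe using (just; nothing; fromMaybe)
open import Data.Nat using (ℕ; zero; suc; _*_; _≤_; _<_; z<s; >-nonZero)
open import Data.Nat.Properties using (1+n≰n; *-cancelˡ-≡; m*n≡0⇒m≡0; <⇒≢; module ≤-Reasoning)
open import Data.Product using (∃; _×_; _,_; proj₁; proj₂)
open import Data.Sum using (inj₁; inj₂)
open import Data.Vec using (Vec; []; _∷_)
import Data.Vec as Vec
open import Data.Vec.Properties using (lookup∘tabulate)
open import Effect.Applicative using (RawApplicative)
open import Effect.Monad using (RawMonad)
open import Level using (0ℓ)
open import Function using (_∘_; id; _⇔_; mk⇔)
open import Function.Definitions using (Injective)
open import Relation.Binary.Definitions using () renaming (Decidable to Decidable₂)
open import Relation.Binary.PropositionalEquality using (_≡_; _≢_; _≗_; refl; sym; trans; cong; cong₂; subst)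
open import Relation.Binary.Structures using (IsEquivalence)
open import Relation.Nullary using (¬_; Dec; yes; no)
open import Relation.Nullary.Decidable using (_×-dec_; map′; does-⇔; decidable-stable; ¬¬-excluded-middle; T?)
open import Relation.Nullary.Negation using (DoubleNegation; ¬¬-Monad)
open import Relation.Unary using (Decidable)

countTrue≡length-filter : ∀ {k} {A : Set} (q : A → Bool) (f : Fin k → A) →
  countTrue (q ∘ f) ≡ length (filter (T? ∘ q) (tabulate f))
countTrue≡length-filter {zero}  q f = refl
countTrue≡length-filter {suc k} q f with q (f zero)
... | true  = cong suc (countTrue≡length-filter q (f ∘ suc))
... | false = countTrue≡length-filter q (f ∘ suc)

lookup-injective : ∀ {A : Set} {xs : List A} → Unique xs → ∀ i j → lookup xs i ≡ lookup xs j → i ≡ j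
lookup-injective (_  ∷ _) zero    zero    _  = refl
lookup-injective (x∉ ∷ _) zero    (suc j) eq = ⊥-elim (All.lookup x∉ (∈-lookup j) eq)
lookup-injective (x∉ ∷ _) (suc i) zero    eq = ⊥-elim (All.lookup x∉ (∈-lookup i) (sym eq))
lookup-injective (_  ∷ u) (suc i) (suc j) eq = cong suc (lookup-injective u i j eq)

map-unique : ∀ {A B : Set} {f : A → B} (g : B → A) {xs : List A} →
  All (λ x → g (f x) ≡ x) xs → Unique xs → Unique (map f xs)
map-unique g {xs} g∘f≡id u = map⁻ {f = g} (subst Unique (trans (sym (map-id-local g∘f≡id)) (map-∘ xs)) u)

injective⇒surjective : ∀ {a b} → a ≡ b → (f : Fin a → Fin b) → Injective _≡_ _≡_ f →
  ∀ y → ∃ λ x → f x ≡ y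
injective⇒surjective {suc a} refl f f-inj y with any? (λ x → f x ≟ᶠ y)
... | yes hit = hit
... | no miss = ⊥-elim (1+n≰n (injective⇒≤ {f = punchOut ∘ avoids} λ {x} {x′} eq →
                  f-inj (punchOut-injective (avoids x) (avoids x′) eq)))
  where
  avoids : ∀ x → y ≢ f x
  avoids x y≡fx = miss (x , sym y≡fx)

find-just : ∀ {A : Set} {P : A → Set} (P? : Decidable P) xs {a} → find P? xs ≡ just a → P a
find-just P? (x ∷ xs) eq with P? x | eq
... | yes px | refl = px
... | no _   | eq′  = find-just P? xs eq′

find-isJust : ∀ {A : Set} {P : A → Set} (P? : Decidable P) {xs} → Any P xs → ∃ λ a → find P? xs ≡ just a
find-isJust P? {x ∷ xs} p with P? x
... | yes _   = x , refl
... | no ¬px  = find-isJust P? (Any.tail ¬px p)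

find-cong : ∀ {A : Set} {P Q : A → Set} (P? : Decidable P) (Q? : Decidable Q) →
  (∀ x → P x ⇔ Q x) → ∀ xs → find P? xs ≡ find Q? xs
find-cong P? Q? P⇔Q [] = refl
find-cong P? Q? P⇔Q (x ∷ xs)
  rewrite does-⇔ (P⇔Q x) (P? x) (Q? x) | find-cong P? Q? P⇔Q xs = refl

IsCard-positive : ∀ {k} {P : Fin k → Set} {c v} → IsCard P c → P v → 0 < c
IsCard-positive (xs , _ , refl , mem) pv with proj₁ (mem _) pv
... | here _  = z<s
... | there _ = z<s

IsCard-transport : ∀ {a b} {P : Fin a → Set} {Q : Fin b → Set} {c}
  (f : Fin a → Fin b) (g : Fin b → Fin a) →
  (∀ {v} → P v → Q (f v)) → (∀ {w} → Q w → P (g w)) →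
  (∀ {v} → P v → g (f v) ≡ v) → (∀ {w} → Q w → f (g w) ≡ w) →
  IsCard P c → IsCard Q c
IsCard-transport {P = P} {Q = Q} f g P⇒Q Q⇒P g∘f≡id f∘g≡id (xs , unique , len , mem) =
  map f xs , map-unique g (All.tabulate (g∘f≡id ∘ member⇒P)) unique ,
  trans (length-map f xs) len , λ w → Q⇒member , member⇒Q
  where
  member⇒P : ∀ {v} → v ∈ xs → P v
  member⇒P {v} = proj₂ (mem v)
  Q⇒member : ∀ {w} → Q w → w ∈ map f xs
  Q⇒member qw = subst (_∈ map f xs) (f∘g≡id qw) (∈-map⁺ f (proj₁ (mem _) (Q⇒P qw)))
  member⇒Q : ∀ {w} → w ∈ map f xs → Q w
  member⇒Q w∈ with ∈-map⁻ f w∈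
  ... | v , v∈ , refl = P⇒Q (member⇒P v∈)

filter-IsCard : ∀ {k} {P : Fin k → Set} (P? : Decidable P) → IsCard P (length (filter P? (allFin k)))
filter-IsCard {k} P? = filter P? (allFin k) , filter⁺-Unique P? (allFin⁺ k) , refl ,
  λ v → ∈-filter⁺ P? (∈-allFin v) , proj₂ ∘ ∈-filter⁻ P? {xs = allFin k}

-- Reachability and component isomorphisms

module _ {G : Graph} where

  Reach-trans : ∀ {x y z} → Reach G x y → Reach G y z → Reach G x z
  Reach-trans r here        = r
  Reach-trans r (step s yz) = step (Reach-trans r s) yz

  Reach-sym : ∀ {x y} → Reach G x y → Reach G y x
  Reach-sym here                = here
  Reach-sym (step {y} {z} r yz) = Reach-trans (step here (trans (Graph.sym G z y) yz)) (Reach-sym r)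

  Reach-isEquivalence : IsEquivalence (Reach G)
  Reach-isEquivalence = record { refl = here ; sym = Reach-sym ; trans = Reach-trans }

  adj-across-components : ∀ {x u w} → Reach G x u → ¬ Reach G x w → adj G u w ≡ false
  adj-across-components {u = u} {w} x~u x≁w with adj G u w in uw
  ... | true  = ⊥-elim (x≁w (step x~u uw))
  ... | false = refl

Iso-sym : ∀ {G H} → Iso G H → Iso H G
Iso-sym {H = H} σ = record
  { to = from σ ; from = to σ ; from-to = to-from σ ; to-from = from-to σ
  ; adj-pres = λ v w → trans (sym (adj-pres σ (from σ v) (from σ w)))
                             (cong₂ (adj H) (to-from σ v) (to-from σ w)) }

Iso-refl : ∀ {G} → Iso G G
Iso-refl = record { to = id ; from = id ; from-to = λ _ → refl ; to-from = λ _ → refl ; adj-pres = λ _ _ → refl }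

Iso-preserves-Reach : ∀ {G H} (σ : Iso G H) {x v} → Reach G x v → Reach H (to σ x) (to σ v)
Iso-preserves-Reach σ here                = here
Iso-preserves-Reach σ (step {y} {z} r yz) = step (Iso-preserves-Reach σ r) (trans (adj-pres σ y z) yz)

Iso⇒CompIso : ∀ {G H} (σ : Iso G H) x → CompIso G x H (to σ x)
Iso⇒CompIso {G} σ x = record
  { cto = to σ ; cfrom = from σ
  ; cto-reach   = λ _ → Iso-preserves-Reach σ
  ; cfrom-reach = λ w r → subst (λ x′ → Reach G x′ (from σ w)) (from-to σ x) (Iso-preserves-Reach (Iso-sym σ) r)
  ; cfrom-to    = λ v _ → from-to σ v
  ; cto-from    = λ w _ → to-from σ w
  ; cadj-pres   = λ v w _ _ → adj-pres σ v w }

CompIso-sym : ∀ {G x H y} → CompIso G x H y → CompIso H y G x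
CompIso-sym {H = H} φ = record
  { cto = cfrom φ ; cfrom = cto φ
  ; cto-reach = cfrom-reach φ ; cfrom-reach = cto-reach φ
  ; cfrom-to = cto-from φ ; cto-from = cfrom-to φ
  ; cadj-pres = λ v w y~v y~w →
      trans (sym (cadj-pres φ (cfrom φ v) (cfrom φ w) (cfrom-reach φ v y~v) (cfrom-reach φ w y~w)))
            (cong₂ (adj H) (cto-from φ v y~v) (cto-from φ w y~w)) }

CompIso-trans : ∀ {G x H y K z} → CompIso G x H y → CompIso H y K z → CompIso G x K z
CompIso-trans φ ψ = record
  { cto = cto ψ ∘ cto φ ; cfrom = cfrom φ ∘ cfrom ψ
  ; cto-reach   = λ v r → cto-reach ψ _ (cto-reach φ v r)
  ; cfrom-reach = λ w r → cfrom-reach φ _ (cfrom-reach ψ w r)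
  ; cfrom-to    = λ v r → trans (cong (cfrom φ) (cfrom-to ψ _ (cto-reach φ v r))) (cfrom-to φ v r)
  ; cto-from    = λ w r → trans (cong (cto ψ) (cto-from φ _ (cfrom-reach ψ w r))) (cto-from ψ w r)
  ; cadj-pres   = λ v w rv rw →
      trans (cadj-pres ψ _ _ (cto-reach φ v rv) (cto-reach φ w rw)) (cadj-pres φ v w rv rw) }

CompIso-reroot : ∀ {G x H y} (φ : CompIso G x H y) {x′} → Reach G x x′ → CompIso G x′ H (cto φ x′)
CompIso-reroot φ x~x′ = record
  { cto = cto φ ; cfrom = cfrom φ
  ; cto-reach   = λ v r → Reach-trans (Reach-sym y~φx′) (cto-reach φ v (Reach-trans x~x′ r))
  ; cfrom-reach = λ w r → Reach-trans (Reach-sym x~x′) (cfrom-reach φ w (Reach-trans y~φx′ r))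
  ; cfrom-to    = λ v r → cfrom-to φ v (Reach-trans x~x′ r)
  ; cto-from    = λ w r → cto-from φ w (Reach-trans y~φx′ r)
  ; cadj-pres   = λ v w rv rw → cadj-pres φ v w (Reach-trans x~x′ rv) (Reach-trans x~x′ rw) }
  where
  y~φx′ = cto-reach φ _ x~x′

RootedIso-sym : ∀ {G x H y} → RootedIso G x H y → RootedIso H y G x
RootedIso-sym (φ , φx≡y) = CompIso-sym φ , trans (cong (cfrom φ) (sym φx≡y)) (cfrom-to φ _ here)

RootedIso-trans : ∀ {G x H y K z} → RootedIso G x H y → RootedIso H y K z → RootedIso G x K z
RootedIso-trans (φ , φx≡y) (ψ , ψy≡z) = CompIso-trans φ ψ , trans (cong (cto ψ) φx≡y) ψy≡z

-- Orbits of the automorphism group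

module ExtendByIdentity (G : Graph) {o v : Fin (n G)} (Reach? : Decidable (Reach G o))
                        (φ : CompIso G o G v) (o~v : Reach G o v) where

  onComponent : (Fin (n G) → Fin (n G)) → Fin (n G) → Fin (n G)
  onComponent h u with Reach? u
  ... | yes _ = h u
  ... | no  _ = u

  onComponent-inside : ∀ h {u} → Reach G o u → onComponent h u ≡ h u
  onComponent-inside h {u} o~u with Reach? u
  ... | yes _   = refl
  ... | no o≁u  = ⊥-elim (o≁u o~u)

  onComponent-outside : ∀ h {u} → ¬ Reach G o u → onComponent h u ≡ u
  onComponent-outside h {u} o≁u with Reach? u
  ... | yes o~u = ⊥-elim (o≁u o~u)
  ... | no  _   = refl

  private
    f g : Fin (n G) → Fin (n G)
    f = onComponent (cto φ)
    g = onComponent (cfrom φ)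

    φ-stays : ∀ {u} → Reach G o u → Reach G o (cto φ u)
    φ-stays o~u = Reach-trans o~v (cto-reach φ _ o~u)

    φ⁻¹-stays : ∀ {u} → Reach G o u → Reach G o (cfrom φ u)
    φ⁻¹-stays o~u = cfrom-reach φ _ (Reach-trans (Reach-sym o~v) o~u)

    g∘f≡id : ∀ u → g (f u) ≡ u
    g∘f≡id u with Reach? u
    ... | yes o~u = trans (onComponent-inside (cfrom φ) (φ-stays o~u)) (cfrom-to φ u o~u)
    ... | no  o≁u = onComponent-outside (cfrom φ) o≁u

    f∘g≡id : ∀ u → f (g u) ≡ u
    f∘g≡id u with Reach? u
    ... | yes o~u = trans (onComponent-inside (cto φ) (φ⁻¹-stays o~u))
                          (cto-from φ u (Reach-trans (Reach-sym o~v) o~u))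
    ... | no  o≁u = onComponent-outside (cto φ) o≁u

    f-adj : ∀ a b → adj G (f a) (f b) ≡ adj G a b
    f-adj a b with Reach? a | Reach? b
    ... | yes o~a | yes o~b = cadj-pres φ a b o~a o~b
    ... | yes o~a | no  o≁b = trans (adj-across-components (φ-stays o~a) o≁b)
                                    (sym (adj-across-components o~a o≁b))
    ... | no  o≁a | yes o~b = trans (Graph.sym G a _)
                                    (trans (adj-across-components (φ-stays o~b) o≁a)
                                           (sym (trans (Graph.sym G a b) (adj-across-components o~b o≁a))))
    ... | no  _   | no  _   = refl

  automorphism : Iso G G
  automorphism = record { to = f ; from = g ; from-to = g∘f≡id ; to-from = f∘g≡id ; adj-pres = f-adj }

module _ {G : Graph} {o v : Fin (n G)} where

  InOrbit⇒RootedIso : InOrbit G o v → RootedIso G o G v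
  InOrbit⇒RootedIso (σ , σo≡v) = subst (RootedIso G o G) σo≡v (Iso⇒CompIso σ o , refl)

  InOrbit⇒Reach : DistinctComponents G → InOrbit G o v → Reach G o v
  InOrbit⇒Reach distinct io = distinct o v (proj₁ (InOrbit⇒RootedIso io))

  RootedIso⇒InOrbit : DistinctComponents G → Decidable (Reach G o) → RootedIso G o G v → InOrbit G o v
  RootedIso⇒InOrbit distinct Reach? (φ , φo≡v) =
    automorphism , trans (onComponent-inside (cto φ) here) φo≡v
    where open ExtendByIdentity G Reach? φ (distinct o v φ)

InOrbit-transport : ∀ {G H o o′ v} → DistinctComponents G → DistinctComponents H →
  Decidable (Reach H o′) → (φ : RootedIso G o H o′) → InOrbit G o v → InOrbit H o′ (cto (proj₁ φ) v)
InOrbit-transport distinctG distinctH Reach? φ io =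
  RootedIso⇒InOrbit distinctH Reach?
    (RootedIso-trans (RootedIso-sym φ)
      (RootedIso-trans (InOrbit⇒RootedIso io) (CompIso-reroot (proj₁ φ) (InOrbit⇒Reach distinctG io) , refl)))

orbitSize-transport : ∀ {G H o o′ c} → DistinctComponents G → DistinctComponents H →
  Decidable (Reach G o) → Decidable (Reach H o′) → RootedIso G o H o′ →
  IsCard (InOrbit G o) c → IsCard (InOrbit H o′) c
orbitSize-transport distinctG distinctH Reach?ᴳ Reach?ᴴ φ =
  IsCard-transport (cto (proj₁ φ)) (cfrom (proj₁ φ))
    (InOrbit-transport distinctG distinctH Reach?ᴴ φ)
    (InOrbit-transport distinctH distinctG Reach?ᴳ (RootedIso-sym φ))
    (λ io → cfrom-to (proj₁ φ) _ (InOrbit⇒Reach distinctG io))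
    (λ io → cto-from (proj₁ φ) _ (InOrbit⇒Reach distinctH io))

-- The component of a vertex as a connected graph

module Component (G : Graph) (o : Fin (n G)) (Reach? : Decidable (Reach G o)) where

  vertices : List (Fin (n G))
  vertices = filter Reach? (allFin (n G))

  size : ℕ
  size = length vertices

  embed : Fin size → Fin (n G)
  embed = lookup vertices

  embed-injective : ∀ {i j} → embed i ≡ embed j → i ≡ j
  embed-injective = lookup-injective (filter⁺-Unique Reach? (allFin⁺ (n G))) _ _

  embed-reach : ∀ i → Reach G o (embed i)
  embed-reach i = proj₂ (∈-filter⁻ Reach? {xs = allFin (n G)} (∈-lookup i))

  index : ∀ {v} → Reach G o v → Fin size
  index {v} o~v = Any.index (∈-filter⁺ Reach? (∈-allFin v) o~v)

  embed-index : ∀ {v} (o~v : Reach G o v) → embed (index o~v) ≡ v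
  embed-index {v} o~v = sym (lookup-index (∈-filter⁺ Reach? (∈-allFin v) o~v))

  graph : Graph
  graph = record
    { n = size ; adj = λ i j → adj G (embed i) (embed j)
    ; sym = λ i j → Graph.sym G (embed i) (embed j) ; irrefl = irrefl G ∘ embed }

  root : Fin size
  root = index here

  lift-path : ∀ i {z} → Reach G (embed i) z → (o~z : Reach G o z) → Reach graph i (index o~z)
  lift-path i here o~z = subst (Reach graph i) (embed-injective (sym (embed-index o~z))) here
  lift-path i (step {y} r yz) o~z =
    step (lift-path i r o~y) (trans (cong₂ (adj G) (embed-index o~y) (embed-index o~z)) yz)
    where
    o~y = Reach-trans (embed-reach i) r

  connected : Connected graph
  connected i j = subst (Reach graph i) (embed-injective (embed-index (embed-reach j)))
    (lift-path i (Reach-trans (Reach-sym (embed-reach i)) (embed-reach j)) (embed-reach j))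

  -- The neighbours of i in the component are those neighbours of embed i that are reachable from o.
  maxDegree : ∀ {M} → MaxDegAtMost M G → MaxDegAtMost M graph
  maxDegree {M} bounded i = begin
    degree graph i                              ≡⟨ countTrue≡length-filter adjᵢ embed ⟩
    length (filter (T? ∘ adjᵢ) (tabulate embed)) ≡⟨ cong (length ∘ filter (T? ∘ adjᵢ)) (tabulate-lookup vertices) ⟩
    length (filter (T? ∘ adjᵢ) vertices)         ≤⟨ length-mono-≤ (filter⁺-⊆ (T? ∘ adjᵢ) (T? ∘ adjᵢ) (λ { refl a → a })
                                                                   (filter-⊆ Reach? (allFin (n G)))) ⟩
    length (filter (T? ∘ adjᵢ) (allFin (n G)))   ≡⟨ sym (countTrue≡length-filter adjᵢ id) ⟩
    degree G (embed i)                          ≤⟨ bounded (embed i) ⟩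
    M                                           ∎
    where
    open ≤-Reasoning
    adjᵢ = adj G (embed i)

  project : Fin (n G) → Fin size
  project v with Reach? v
  ... | yes o~v = index o~v
  ... | no  _   = root

  embed-project : ∀ {v} → Reach G o v → embed (project v) ≡ v
  embed-project {v} o~v with Reach? v
  ... | yes o~v′ = embed-index o~v′
  ... | no  o≁v  = ⊥-elim (o≁v o~v)

  rootedIso : RootedIso G o graph root
  rootedIso = record
    { cto = project ; cfrom = embed
    ; cto-reach   = λ v _ → connected root (project v)
    ; cfrom-reach = λ i _ → embed-reach i
    ; cfrom-to    = λ v o~v → embed-project o~v
    ; cto-from    = λ i _ → embed-injective (embed-project (embed-reach i))
    ; cadj-pres   = λ v w o~v o~w → cong₂ (adj G) (embed-project o~v) (embed-project o~w) }
    , embed-injective (trans (embed-project here) (sym (embed-index here)))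

-- Gluing component isomorphisms into a graph isomorphism

module CanonicalRepresentative {k} {R : Fin k → Fin k → Set} (R? : Decidable₂ R)
                               (equivalence : IsEquivalence R) where

  open IsEquivalence equivalence renaming (refl to R-refl; sym to R-sym; trans to R-trans)

  representative : Fin k → Fin k
  representative v = fromMaybe v (find (λ u → R? u v) (allFin k))

  representative-related : ∀ v → R (representative v) v
  representative-related v with find (λ u → R? u v) (allFin k) in found
  ... | just u  = find-just (λ u → R? u v) (allFin k) found
  ... | nothing = R-refl

  representative-cong : ∀ {v w} → R v w → representative v ≡ representative w
  representative-cong {v} {w} v~w = trans (cong (fromMaybe v) found-v) (sym (cong (fromMaybe w) found-w))
    where
    first = find-isJust (λ u → R? u v) (Any.map (λ { refl → R-refl }) (∈-allFin v))
    found-v = proj₂ first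
    found-w : find (λ u → R? u w) (allFin k) ≡ just (proj₁ first)
    found-w = trans (sym (find-cong (λ u → R? u v) (λ u → R? u w)
                            (λ u → mk⇔ (λ u~v → R-trans u~v v~w) (λ u~w → R-trans u~w (R-sym v~w)))
                            (allFin k)))
                    found-v

Iso-fromInjective : ∀ {G H} → n G ≡ n H → (f : Fin (n G) → Fin (n H)) → Injective _≡_ _≡_ f →
  (∀ v w → adj H (f v) (f w) ≡ adj G v w) → Iso G H
Iso-fromInjective |G|≡|H| f f-inj f-adj = record
  { to = f ; from = proj₁ ∘ onto ; from-to = λ v → f-inj (proj₂ (onto (f v)))
  ; to-from = proj₂ ∘ onto ; adj-pres = f-adj }
  where
  onto = injective⇒surjective |G|≡|H| f f-inj

module Glue (G H : Graph) (distinct : DistinctComponents G) (Reach? : Decidable₂ (Reach G))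
            (partner : Fin (n G) → Fin (n H)) (φ : ∀ v → CompIso G v H (partner v)) where

  open CanonicalRepresentative Reach? Reach-isEquivalence

  glued : Fin (n G) → Fin (n H)
  glued v = cto (φ (representative v)) v

  glued-sameComponent : ∀ {v w} → Reach G v w → glued w ≡ cto (φ (representative v)) w
  glued-sameComponent {w = w} v~w = cong (λ a → cto (φ a) w) (sym (representative-cong v~w))

  partners-reflect-Reach : ∀ a b → Reach H (partner a) (partner b) → Reach G a b
  partners-reflect-Reach a b pa~pb =
    Reach-trans (distinct a _ (CompIso-trans (φ a) (CompIso-reroot (CompIso-sym (φ b)) (Reach-sym pa~pb))))
                (Reach-sym (cfrom-reach (φ b) _ (Reach-sym pa~pb)))

  glued-reflects-Reach : ∀ v w → Reach H (glued v) (glued w) → Reach G v w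
  glued-reflects-Reach v w gv~gw =
    Reach-trans (Reach-sym (representative-related v))
      (Reach-trans (partners-reflect-Reach _ _
                     (Reach-trans (toPartner v) (Reach-trans gv~gw (Reach-sym (toPartner w)))))
                   (representative-related w))
    where
    toPartner : ∀ u → Reach H (partner (representative u)) (glued u)
    toPartner u = cto-reach (φ (representative u)) u (representative-related u)

  glued-injective : Injective _≡_ _≡_ glued
  glued-injective {v} {w} gv≡gw =
    trans (sym (cfrom-to φᵥ v (representative-related v)))
      (trans (cong (cfrom φᵥ) (trans gv≡gw (glued-sameComponent v~w)))
             (cfrom-to φᵥ w (Reach-trans (representative-related v) v~w)))
    where
    φᵥ = φ (representative v)
    v~w = glued-reflects-Reach v w (subst (Reach H (glued v)) gv≡gw here)

  glued-adj : ∀ v w → adj H (glued v) (glued w) ≡ adj G v w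
  glued-adj v w with Reach? v w
  ... | yes v~w = trans (cong (adj H (glued v)) (glued-sameComponent v~w))
                        (cadj-pres (φ (representative v)) v w (representative-related v)
                                   (Reach-trans (representative-related v) v~w))
  ... | no v≁w with adj H (glued v) (glued w) in gvgw
  ...   | true  = ⊥-elim (v≁w (glued-reflects-Reach v w (step here gvgw)))
  ...   | false = sym (adj-across-components here v≁w)

  iso : n G ≡ n H → Iso G H
  iso |G|≡|H| = Iso-fromInjective |G|≡|H| glued glued-injective glued-adj

-- Isomorphism of finite graphs is decidable

∃-Vec? : ∀ {b} a {P : Vec (Fin b) a → Set} → Decidable P → Dec (∃ P)
∃-Vec? zero    P? = map′ ([] ,_) (λ { ([] , p) → p }) (P? [])
∃-Vec? (suc a) P? = map′ (λ (x , xs , p) → x ∷ xs , p) (λ { (x ∷ xs , p) → x , xs , p })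
                         (any? λ x → ∃-Vec? a (P? ∘ (x ∷_)))

module _ (G H : Graph) where

  IsIsoPair : (Fin (n G) → Fin (n H)) → (Fin (n H) → Fin (n G)) → Set
  IsIsoPair t f = (∀ v → f (t v) ≡ v) × (∀ w → t (f w) ≡ w) × (∀ v w → adj H (t v) (t w) ≡ adj G v w)

  IsIsoPair? : ∀ t f → Dec (IsIsoPair t f)
  IsIsoPair? t f = all? (λ v → f (t v) ≟ᶠ v) ×-dec all? (λ w → t (f w) ≟ᶠ w) ×-dec
                   all? (λ v → all? (λ w → adj H (t v) (t w) Bool.≟ adj G v w))

  IsIsoPair-resp : ∀ {t t′ f f′} → t ≗ t′ → f ≗ f′ → IsIsoPair t f → IsIsoPair t′ f′
  IsIsoPair-resp {t} {t′} {f} {f′} t≗t′ f≗f′ (f∘t≡id , t∘f≡id , t-adj) =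
    (λ v → trans (sym (trans (cong f (t≗t′ v)) (f≗f′ (t′ v)))) (f∘t≡id v)) ,
    (λ w → trans (sym (trans (cong t (f≗f′ w)) (t≗t′ (f′ w)))) (t∘f≡id w)) ,
    (λ v w → trans (sym (cong₂ (adj H) (t≗t′ v) (t≗t′ w))) (t-adj v w))

  Iso? : Dec (Iso G H)
  Iso? = map′ fromTables toTables
    (∃-Vec? (n G) λ tv → ∃-Vec? (n H) λ fv → IsIsoPair? (Vec.lookup tv) (Vec.lookup fv))
    where
    fromTables : (∃ λ tv → ∃ λ fv → IsIsoPair (Vec.lookup tv) (Vec.lookup fv)) → Iso G H
    fromTables (tv , fv , f∘t≡id , t∘f≡id , t-adj) =
      record { to = Vec.lookup tv ; from = Vec.lookup fv ; from-to = f∘t≡id ; to-from = t∘f≡id ; adj-pres = t-adj }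
    toTables : Iso G H → ∃ λ tv → ∃ λ fv → IsIsoPair (Vec.lookup tv) (Vec.lookup fv)
    toTables σ = Vec.tabulate (to σ) , Vec.tabulate (from σ) ,
      IsIsoPair-resp (sym ∘ lookup∘tabulate (to σ)) (sym ∘ lookup∘tabulate (from σ))
                     (from-to σ , to-from σ , adj-pres σ)

¬¬-applicative : RawApplicative {0ℓ} DoubleNegation
¬¬-applicative = RawMonad.rawApplicative ¬¬-Monad

¬¬-decidable₂ : ∀ {k} (R : Fin k → Fin k → Set) → DoubleNegation (Decidable₂ R)
¬¬-decidable₂ R = sequence ¬¬-applicative (λ x → sequence ¬¬-applicative (λ y → ¬¬-excluded-middle))

-- Reading off the law at the component of a vertex

module LawAtVertex {M} {G H : Graph} (law : LawEq M G H) (bounded : MaxDegAtMost M G)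
                   (Reach? : Decidable₂ (Reach G)) (InOrbit? : Decidable₂ (InOrbit G)) (o : Fin (n G)) where

  open Component G o (Reach? o) using (graph; root; connected; maxDegree; rootedIso)

  orbitSize : ℕ
  orbitSize = length (filter (InOrbit? o) (allFin (n G)))

  orbitSize-IsCard : IsCard (InOrbit G o) orbitSize
  orbitSize-IsCard = filter-IsCard (InOrbit? o)

  orbitSize-positive : 0 < orbitSize
  orbitSize-positive = IsCard-positive orbitSize-IsCard (Iso-refl , refl)

  law-at-root : ∀ {m} → PsiNum H graph root m → orbitSize * n H ≡ m * n G
  law-at-root {m} = law graph root connected (maxDegree bounded) orbitSize m (inj₁ (o , rootedIso , orbitSize-IsCard))

  matchingVertex : 0 < n H → Dec (∃ λ o′ → RootedIso H o′ graph root) → ∃ λ o′ → RootedIso G o H o′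
  matchingVertex _ (yes (o′ , ψ)) = o′ , RootedIso-trans rootedIso (RootedIso-sym ψ)
  matchingVertex 0<|H| (no unmatched) = ⊥-elim (<⇒≢ orbitSize-positive (sym orbitSize≡0))
    where
    orbitSize≡0 : orbitSize ≡ 0
    orbitSize≡0 = m*n≡0⇒m≡0 orbitSize (n H) ⦃ >-nonZero 0<|H| ⦄ (law-at-root (inj₂ (unmatched , refl)))

  sameOrder : DistinctComponents G → DistinctComponents H → Decidable₂ (Reach H) →
    ∀ {o′} → RootedIso G o H o′ → n G ≡ n H
  sameOrder distinctG distinctH Reach?ᴴ {o′} φ =
    sym (*-cancelˡ-≡ (n H) (n G) orbitSize ⦃ >-nonZero orbitSize-positive ⦄ (law-at-root (inj₁ (o′ , ψ , orbit′))))
    where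
    ψ = RootedIso-trans (RootedIso-sym φ) rootedIso
    orbit′ = orbitSize-transport distinctG distinctH (Reach? o) (Reach?ᴴ o′) φ orbitSize-IsCard

mainTheorem7 : (M : ℕ) → 1 ≤ M → (G H : Graph) →
    0 < n G → 0 < n H → MaxDegAtMost M G → MaxDegAtMost M H →
    DistinctComponents G → DistinctComponents H →
    LawEq M G H → Iso G H
mainTheorem7 M _ G H 0<|G| 0<|H| boundedG _ distinctG distinctH law = decidable-stable (Iso? G H) do
  Reach?ᴳ  ← ¬¬-decidable₂ (Reach G)
  Reach?ᴴ  ← ¬¬-decidable₂ (Reach H)
  InOrbit? ← ¬¬-decidable₂ (InOrbit G)
  let open LawAtVertex law boundedG Reach?ᴳ InOrbit?
  match ← sequence ¬¬-applicative λ o → matchingVertex o 0<|H| <$> ¬¬-excluded-middle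
  let open Glue G H distinctG Reach?ᴳ (proj₁ ∘ match) (proj₁ ∘ proj₂ ∘ match)
      o = fromℕ< 0<|G|
  pure (iso (sameOrder o distinctG distinctH Reach?ᴴ (proj₂ (match o))))
  where open RawMonad ¬¬-Monad
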